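{- Fix integers $n\ge 2$ and $t\ge 0$, and let $\pi$ be the random permutation of $\{1,\dots,n\}$ obtained as the product of $t$ transpositions chosen independently and uniformly at random from all transpositions of $S_n$. Then for $1\le i<j\le n$, the probability $\Pr(\pi_i>\pi_j)$ depends only on $j-i$ (i.e.\ $\Pr(\pi_i>\pi_j)=\Pr(\pi_{i'}>\pi_{j'})$ whenever $1\le i<j\le n$, $1\le i'<j'\le n$ and $j-i=j'-i'$). -}

module Defs where

open import Data.Nat using (ℕ; zero; suc; _<_; _<ᵇ_; pred)
open import Data.Integer using (+_)
open import Data.Fin using (Fin; toℕ; _≟_)
open import Data.List using (List; []; _∷_; map; concatMap; filter; length; allFin)
open import Data.Product using (_×_; _,_)
open import Data.Bool using (Bool; true; false; if_then_else_)
open import Data.Nat.Properties using (_<?_)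
open import Relation.Nullary.Decidable using (⌊_⌋)
open import Data.Rational.Unnormalised using (ℚᵘ; mkℚᵘ)

-- A transposition of {0,…,n-1} (= Fin n) is represented by a pair (a , b) with a < b.
Transp : ℕ → Set
Transp n = Fin n × Fin n

transpositions : (n : ℕ) → List (Transp n)
transpositions n =
  concatMap (λ a → map (λ b → (a , b)) (filter (λ b → toℕ a <? toℕ b) (allFin n))) (allFin n)

-- The sample space: all sequences (τ₁,…,τ_t) of t transpositions (uniform measure).
sequences : (n t : ℕ) → List (List (Transp n))
sequences n zero    = [] ∷ []
sequences n (suc t) = concatMap (λ τ → map (τ ∷_) (sequences n t)) (transpositions n)

swap : {n : ℕ} → Fin n → Fin n → Fin n → Fin n
swap a b x = if ⌊ x ≟ a ⌋ then b else (if ⌊ x ≟ b ⌋ then a else x)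

product : {n : ℕ} → List (Transp n) → Fin n → Fin n
product []             x = x
product ((a , b) ∷ ts) x = swap a b (product ts x)

countInv : (n t : ℕ) → Fin n → Fin n → ℕ
countInv n t i j =
  length (filter (λ s → toℕ (product s j) <? toℕ (product s i)) (sequences n t))

-- Pr(π_i > π_j) = countInv / |sample space|, as an unnormalised rational.
-- mkℚᵘ p q denotes p / (q+1); the sample space has (n(n-1)/2)^t ≥ 1 elements when n ≥ 2,
-- so pred of its size + 1 is its size.
Pr-inv : (n t : ℕ) → Fin n → Fin n → ℚᵘ
Pr-inv n t i j = mkℚᵘ (+ countInv n t i j) (pred (length (sequences n t)))

-- Write (T g)(a, b) = Σ_τ g(τ a, τ b) for g : Fin n → Fin n → ℤ, the sum running over all
-- transpositions (swapSum).  As π = τ₁ ∘ ⋯ ∘ τ_t, summing g(π x, π y) over the sequences of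
-- length t + 1 is summing (T g)(π x, π y) over those of length t, so the number of sequences
-- with π i > π j is (Tᵗ g₀)(i, j) with g₀(x, y) = [y < x].  The functions
-- A[y < x] + B(y − x) + C + D[x = y] form a T-invariant space containing g₀ (the four
-- coefficients transform linearly), and below the diagonal such a function is
-- B(y − x) + C, which depends on y − x only.

module Submission where

open import Defs
open import Data.Nat using (ℕ; zero; suc; _≤_; _<_; _∸_; s≤s)
import Data.Nat.Properties as ℕ
open import Data.Nat.Properties using (_<?_)
open import Data.Integer using (ℤ; +_; 0ℤ; 1ℤ; _+_; _*_; _-_)
import Data.Integer.Properties as ℤ
open import Data.Integer.Tactic.RingSolver using (solve-∀)
open import Data.Fin using (Fin; zero; suc; toℕ; _≟_)
open import Data.Fin.Properties using (toℕ-injective; toℕ<n; suc-injective)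
open import Data.List using (List; []; _∷_; _++_; map; concatMap; filter; length; allFin; tabulate)
open import Data.Product using (_,_; uncurry)
open import Data.Bool using (true; false; if_then_else_)
open import Function using (_∘_)
open import Relation.Nullary using (Dec; yes; no; does; ¬_; contradiction)
open import Relation.Nullary.Decidable using (dec-true; dec-false)
open import Relation.Unary using (Pred; Decidable)
open import Relation.Binary using (tri<; tri≈; tri>)
open import Relation.Binary.PropositionalEquality using (_≡_; _≢_; refl; sym; trans; cong; cong₂; module ≡-Reasoning)
open import Data.Rational.Unnormalised using (_≃_)
open import Data.Rational.Unnormalised.Properties using (≃-refl)
open import Algebra.Properties.Semiring.Sum ℤ.+-*-semiring
  using (sum; sum-syntax; sum-cong-≗; ∑-distrib-+; ∑-comm; sum-replicate-zero; *-distribˡ-sum)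

-- Finite sums and indicators

⟦_⟧ : {P : Set} → Dec P → ℤ
⟦ P? ⟧ = if does P? then 1ℤ else 0ℤ

⟦⟧-yes : {P : Set} (P? : Dec P) → P → ⟦ P? ⟧ ≡ 1ℤ
⟦⟧-yes P? p rewrite dec-true P? p = refl

⟦⟧-no : {P : Set} (P? : Dec P) → ¬ P → ⟦ P? ⟧ ≡ 0ℤ
⟦⟧-no P? ¬p rewrite dec-false P? ¬p = refl

sumOver : {A : Set} → List A → (A → ℤ) → ℤ
sumOver []       f = 0ℤ
sumOver (x ∷ xs) f = f x + sumOver xs f

module _ {A : Set} where

  sumOver-cong : (xs : List A) {f g : A → ℤ} → (∀ x → f x ≡ g x) → sumOver xs f ≡ sumOver xs g
  sumOver-cong []       f≗g = refl
  sumOver-cong (x ∷ xs) f≗g = cong₂ _+_ (f≗g x) (sumOver-cong xs f≗g)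

  sumOver-++ : (xs ys : List A) (f : A → ℤ) → sumOver (xs ++ ys) f ≡ sumOver xs f + sumOver ys f
  sumOver-++ []       ys f = sym (ℤ.+-identityˡ _)
  sumOver-++ (x ∷ xs) ys f = trans (cong (_+_ (f x)) (sumOver-++ xs ys f)) (sym (ℤ.+-assoc (f x) _ _))

  sumOver-const : (xs : List A) (k : ℤ) → sumOver xs (λ _ → k) ≡ + length xs * k
  sumOver-const []       k = refl
  sumOver-const (x ∷ xs) k = begin
    k + sumOver xs (λ _ → k)  ≡⟨ cong (_+_ k) (sumOver-const xs k) ⟩
    k + + length xs * k       ≡⟨ sym (ℤ.suc-* (+ length xs) k) ⟩
    + length (x ∷ xs) * k     ∎
    where open ≡-Reasoning

  sumOver-distrib-+ : (xs : List A) (f g : A → ℤ) → sumOver xs (λ x → f x + g x) ≡ sumOver xs f + sumOver xs g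
  sumOver-distrib-+ []       f g = refl
  sumOver-distrib-+ (x ∷ xs) f g =
    trans (cong (_+_ (f x + g x)) (sumOver-distrib-+ xs f g)) (interchange (f x) (g x) _ _)
    where
    interchange : ∀ a b c d → a + b + (c + d) ≡ a + c + (b + d)
    interchange = solve-∀

  sumOver-filter : {P : Pred A _} (P? : Decidable P) (xs : List A) (f : A → ℤ) →
    sumOver (filter P? xs) f ≡ sumOver xs (λ x → ⟦ P? x ⟧ * f x)
  sumOver-filter P? []       f = refl
  sumOver-filter P? (x ∷ xs) f with does (P? x)
  ... | true  = cong₂ _+_ (sym (ℤ.*-identityˡ (f x))) (sumOver-filter P? xs f)
  ... | false = trans (sumOver-filter P? xs f) (sym (ℤ.+-identityˡ _))

  length-filter : {P : Pred A _} (P? : Decidable P) (xs : List A) →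
    + length (filter P? xs) ≡ sumOver xs (λ x → ⟦ P? x ⟧)
  length-filter P? xs = begin
    + length (filter P? xs)                     ≡⟨ sym (ℤ.*-identityʳ _) ⟩
    + length (filter P? xs) * 1ℤ                ≡⟨ sym (sumOver-const (filter P? xs) 1ℤ) ⟩
    sumOver (filter P? xs) (λ _ → 1ℤ)           ≡⟨ sumOver-filter P? xs (λ _ → 1ℤ) ⟩
    sumOver xs (λ x → ⟦ P? x ⟧ * 1ℤ)           ≡⟨ sumOver-cong xs (λ x → ℤ.*-identityʳ ⟦ P? x ⟧) ⟩
    sumOver xs (λ x → ⟦ P? x ⟧)                ∎
    where open ≡-Reasoning

module _ {A B : Set} where

  sumOver-map : (h : A → B) (xs : List A) (f : B → ℤ) → sumOver (map h xs) f ≡ sumOver xs (f ∘ h)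
  sumOver-map h []       f = refl
  sumOver-map h (x ∷ xs) f = cong (_+_ (f (h x))) (sumOver-map h xs f)

  sumOver-concatMap : (h : A → List B) (xs : List A) (f : B → ℤ) →
    sumOver (concatMap h xs) f ≡ sumOver xs (λ x → sumOver (h x) f)
  sumOver-concatMap h []       f = refl
  sumOver-concatMap h (x ∷ xs) f =
    trans (sumOver-++ (h x) (concatMap h xs) f) (cong (_+_ (sumOver (h x) f)) (sumOver-concatMap h xs f))

  sumOver-comm : (xs : List A) (ys : List B) (f : A → B → ℤ) →
    sumOver xs (λ x → sumOver ys (f x)) ≡ sumOver ys (λ y → sumOver xs (λ x → f x y))
  sumOver-comm []       ys f = sym (trans (sumOver-const ys 0ℤ) (ℤ.*-zeroʳ (+ length ys)))
  sumOver-comm (x ∷ xs) ys f =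
    trans (cong (_+_ (sumOver ys (f x))) (sumOver-comm xs ys f))
          (sym (sumOver-distrib-+ ys (f x) (λ y → sumOver xs (λ x′ → f x′ y))))

sumOver-tabulate : {A : Set} (n : ℕ) (g : Fin n → A) (f : A → ℤ) → sumOver (tabulate g) f ≡ sum (f ∘ g)
sumOver-tabulate zero    g f = refl
sumOver-tabulate (suc n) g f = cong (_+_ (f (g zero))) (sumOver-tabulate n (g ∘ suc) f)

sumOver-allFin : (n : ℕ) (f : Fin n → ℤ) → sumOver (allFin n) f ≡ sum f
sumOver-allFin n f = sumOver-tabulate n (λ i → i) f

∑-const : (n : ℕ) (k : ℤ) → ∑[ _ < n ] k ≡ + n * k
∑-const zero    k = refl
∑-const (suc n) k = trans (cong (_+_ k) (∑-const n k)) (sym (ℤ.suc-* (+ n) k))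

∑-agreeExcept : {n : ℕ} {f h : Fin n → ℤ} (a : Fin n) →
  (∀ q → q ≢ a → f q ≡ h q) → sum f ≡ sum h + (f a - h a)
∑-agreeExcept {suc n} {f} {h} zero agree =
  trans (cong (_+_ (f zero)) (sum-cong-≗ (λ q → agree (suc q) λ ()))) (rearrange (f zero) (h zero) _)
  where
  rearrange : ∀ x y s → x + s ≡ y + s + (x - y)
  rearrange = solve-∀
∑-agreeExcept {suc n} {f} {h} (suc a) agree =
  trans (cong₂ _+_ (agree zero λ ()) (∑-agreeExcept a (λ q q≢a → agree (suc q) (q≢a ∘ suc-injective))))
        (sym (ℤ.+-assoc (h zero) _ _))

∑-agreeExcept₂ : {n : ℕ} {f h : Fin n → ℤ} (a b : Fin n) → a ≢ b →
  (∀ q → q ≢ a → q ≢ b → f q ≡ h q) → sum f ≡ sum h + (f a - h a) + (f b - h b)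
∑-agreeExcept₂ zero zero a≢b agree = contradiction refl a≢b
∑-agreeExcept₂ {suc n} {f} {h} zero (suc b) a≢b agree =
  trans (cong (_+_ (f zero)) (∑-agreeExcept b (λ q q≢b → agree (suc q) (λ ()) (q≢b ∘ suc-injective))))
        (rearrange (f zero) (h zero) _ _)
  where
  rearrange : ∀ x y s d → x + (s + d) ≡ y + s + (x - y) + d
  rearrange = solve-∀
∑-agreeExcept₂ {suc n} {f} {h} (suc a) zero a≢b agree =
  trans (cong (_+_ (f zero)) (∑-agreeExcept a (λ q q≢a → agree (suc q) (q≢a ∘ suc-injective) (λ ()))))
        (rearrange (f zero) (h zero) _ _)
  where
  rearrange : ∀ x y s d → x + (s + d) ≡ y + s + d + (x - y)
  rearrange = solve-∀
∑-agreeExcept₂ {suc n} {f} {h} (suc a) (suc b) a≢b agree =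
  trans (cong₂ _+_ (agree zero (λ ()) (λ ()))
          (∑-agreeExcept₂ a b (a≢b ∘ cong suc) (λ q q≢a q≢b → agree (suc q) (q≢a ∘ suc-injective) (q≢b ∘ suc-injective))))
        (rearrange (h zero) _ _ _)
  where
  rearrange : ∀ x s d e → x + (s + d + e) ≡ x + s + d + e
  rearrange = solve-∀

∑-sift : {n : ℕ} (b : Fin n) (f : Fin n → ℤ) → ∑[ c < n ] (⟦ b ≟ c ⟧ * f c) ≡ f b
∑-sift {n} b f = begin
  ∑[ c < n ] (⟦ b ≟ c ⟧ * f c)           ≡⟨ ∑-agreeExcept b (λ c c≢b → cong (_* f c) (⟦⟧-no (b ≟ c) (c≢b ∘ sym))) ⟩
  ∑[ _ < n ] 0ℤ + (⟦ b ≟ b ⟧ * f b - 0ℤ) ≡⟨ cong₂ (λ s δ → s + (δ * f b - 0ℤ)) (sum-replicate-zero n) (⟦⟧-yes (b ≟ b) refl) ⟩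
  0ℤ + (1ℤ * f b - 0ℤ)                   ≡⟨ simplify (f b) ⟩
  f b                                    ∎
  where
  open ≡-Reasoning
  simplify : ∀ x → 0ℤ + (1ℤ * x - 0ℤ) ≡ x
  simplify = solve-∀

⟦≟⟧-sym : {n : ℕ} (p q : Fin n) → ⟦ p ≟ q ⟧ ≡ ⟦ q ≟ p ⟧
⟦≟⟧-sym p q with p ≟ q | q ≟ p
... | yes _   | yes _   = refl
... | no  _   | no  _   = refl
... | yes p≡q | no  q≢p = contradiction (sym p≡q) q≢p
... | no  p≢q | yes q≡p = contradiction (sym q≡p) p≢q

trichotomy-indicators : {n : ℕ} (p q : Fin n) →
  ⟦ toℕ p <? toℕ q ⟧ + ⟦ toℕ q <? toℕ p ⟧ + ⟦ p ≟ q ⟧ ≡ 1ℤ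
trichotomy-indicators p q with ℕ.<-cmp (toℕ p) (toℕ q)
... | tri< p<q p≢q p≯q
  rewrite ⟦⟧-yes (toℕ p <? toℕ q) p<q | ⟦⟧-no (toℕ q <? toℕ p) p≯q | ⟦⟧-no (p ≟ q) (p≢q ∘ cong toℕ) = refl
... | tri≈ p≮q p≡q p≯q
  rewrite ⟦⟧-no (toℕ p <? toℕ q) p≮q | ⟦⟧-no (toℕ q <? toℕ p) p≯q | ⟦⟧-yes (p ≟ q) (toℕ-injective p≡q) = refl
... | tri> p≮q p≢q p>q
  rewrite ⟦⟧-no (toℕ p <? toℕ q) p≮q | ⟦⟧-yes (toℕ q <? toℕ p) p>q | ⟦⟧-no (p ≟ q) (p≢q ∘ cong toℕ) = refl

∑-⟦<⟧ : (n m : ℕ) → m ≤ n → ∑[ c < n ] ⟦ toℕ c <? m ⟧ ≡ + m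
∑-⟦<⟧ n       zero    _         = sum-replicate-zero n
∑-⟦<⟧ (suc n) (suc m) (s≤s m≤n) = cong (_+_ 1ℤ) (∑-⟦<⟧ n m m≤n)

∑-⟦≟⟧ : {n : ℕ} (b : Fin n) → ∑[ c < n ] ⟦ b ≟ c ⟧ ≡ 1ℤ
∑-⟦≟⟧ b = trans (sym (sum-cong-≗ (λ c → ℤ.*-identityʳ ⟦ b ≟ c ⟧))) (∑-sift b (λ _ → 1ℤ))

∑-⟦>⟧ : {n : ℕ} (b : Fin n) → ∑[ c < n ] ⟦ toℕ b <? toℕ c ⟧ ≡ + n - + toℕ b - 1ℤ
∑-⟦>⟧ {n} b = begin
  X                  ≡⟨ isolate X Y Z ⟩
  X + Y + Z - Y - Z  ≡⟨ cong₂ (λ total y → total - y - Z) partition (∑-⟦<⟧ n (toℕ b) (ℕ.<⇒≤ (toℕ<n b))) ⟩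
  + n - + toℕ b - Z  ≡⟨ cong (_-_ (+ n - + toℕ b)) (∑-⟦≟⟧ b) ⟩
  + n - + toℕ b - 1ℤ ∎
  where
  open ≡-Reasoning
  X = ∑[ c < n ] ⟦ toℕ b <? toℕ c ⟧
  Y = ∑[ c < n ] ⟦ toℕ c <? toℕ b ⟧
  Z = ∑[ c < n ] ⟦ b ≟ c ⟧
  isolate : ∀ x y z → x ≡ x + y + z - y - z
  isolate = solve-∀
  partition : X + Y + Z ≡ + n
  partition = begin
    X + Y + Z  ≡⟨ cong (_+ Z) (sym (∑-distrib-+ {n} _ _)) ⟩
    ∑[ c < n ] (⟦ toℕ b <? toℕ c ⟧ + ⟦ toℕ c <? toℕ b ⟧) + Z
               ≡⟨ sym (∑-distrib-+ {n} _ _) ⟩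
    ∑[ c < n ] (⟦ toℕ b <? toℕ c ⟧ + ⟦ toℕ c <? toℕ b ⟧ + ⟦ b ≟ c ⟧)
               ≡⟨ sum-cong-≗ (trichotomy-indicators b) ⟩
    ∑[ _ < n ] 1ℤ ≡⟨ ∑-const n 1ℤ ⟩
    + n * 1ℤ   ≡⟨ ℤ.*-identityʳ (+ n) ⟩
    + n        ∎

-- Transpositions

swap-left : {n : ℕ} (p q : Fin n) → swap p q p ≡ q
swap-left p q with p ≟ p
... | yes _   = refl
... | no  p≢p = contradiction refl p≢p

swap-right : {n : ℕ} (p q : Fin n) → swap p q q ≡ p
swap-right p q with q ≟ p | q ≟ q
... | yes q≡p | _       = q≡p
... | no  _   | yes _   = refl
... | no  _   | no  q≢q = contradiction refl q≢q

swap-fix : {n : ℕ} {p q x : Fin n} → x ≢ p → x ≢ q → swap p q x ≡ x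
swap-fix {p = p} {q} {x} x≢p x≢q with x ≟ p | x ≟ q
... | yes x≡p | _       = contradiction x≡p x≢p
... | no  _   | yes x≡q = contradiction x≡q x≢q
... | no  _   | no  _   = refl

swap-self : {n : ℕ} (p x : Fin n) → swap p p x ≡ x
swap-self p x with x ≟ p
... | yes x≡p = sym x≡p
... | no  _   = refl

swap-comm : {n : ℕ} (p q x : Fin n) → swap p q x ≡ swap q p x
swap-comm p q x with x ≟ p | x ≟ q
... | yes x≡p | yes x≡q = trans (sym x≡q) x≡p
... | yes _   | no  _   = refl
... | no  _   | yes _   = refl
... | no  _   | no  _   = refl

sumOver-transpositions : (n : ℕ) (H : Transp n → ℤ) →
  sumOver (transpositions n) H ≡ ∑[ p < n ] ∑[ q < n ] (⟦ toℕ p <? toℕ q ⟧ * H (p , q))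
sumOver-transpositions n H = begin
  sumOver (transpositions n) H
    ≡⟨ sumOver-concatMap _ (allFin n) H ⟩
  sumOver (allFin n) (λ p → sumOver (map (p ,_) (filter (λ q → toℕ p <? toℕ q) (allFin n))) H)
    ≡⟨ sumOver-cong (allFin n) row ⟩
  sumOver (allFin n) (λ p → ∑[ q < n ] (⟦ toℕ p <? toℕ q ⟧ * H (p , q)))
    ≡⟨ sumOver-allFin n _ ⟩
  ∑[ p < n ] ∑[ q < n ] (⟦ toℕ p <? toℕ q ⟧ * H (p , q)) ∎
  where
  open ≡-Reasoning
  row : ∀ p → sumOver (map (p ,_) (filter (λ q → toℕ p <? toℕ q) (allFin n))) H
            ≡ ∑[ q < n ] (⟦ toℕ p <? toℕ q ⟧ * H (p , q))
  row p = trans (sumOver-map (p ,_) (filter (λ q → toℕ p <? toℕ q) (allFin n)) H)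
         (trans (sumOver-filter (λ q → toℕ p <? toℕ q) (allFin n) (λ q → H (p , q)))
                (sumOver-allFin n _))

sumOver-transpositions-symmetric : (n : ℕ) (F : Fin n → Fin n → ℤ) → (∀ p q → F p q ≡ F q p) →
  + 2 * sumOver (transpositions n) (uncurry F) ≡ ∑[ p < n ] ∑[ q < n ] F p q - ∑[ p < n ] F p p
sumOver-transpositions-symmetric n F F-sym = begin
  + 2 * S                          ≡⟨ double S D ⟩
  S + S + D - D                    ≡⟨ cong (λ s → s + S + D - D) S≡lower ⟩
  Lower + S + D - D                ≡⟨ cong (λ s → Lower + s + D - D) S≡lower ⟩
  Lower + Lower + D - D            ≡⟨ cong (λ u → Lower + u + D - D) (sym upper≡lower) ⟩
  Lower + Upper + D - D            ≡⟨ cong (_- D) (sym total) ⟩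
  ∑[ p < n ] ∑[ q < n ] F p q - D  ∎
  where
  open ≡-Reasoning
  S = sumOver (transpositions n) (uncurry F)
  D = ∑[ p < n ] F p p
  Lower = ∑[ p < n ] ∑[ q < n ] (⟦ toℕ p <? toℕ q ⟧ * F p q)
  Upper = ∑[ p < n ] ∑[ q < n ] (⟦ toℕ q <? toℕ p ⟧ * F p q)

  double : ∀ s d → + 2 * s ≡ s + s + d - d
  double = solve-∀

  S≡lower : S ≡ Lower
  S≡lower = sumOver-transpositions n (uncurry F)

  upper≡lower : Upper ≡ Lower
  upper≡lower = trans (∑-comm (λ p q → ⟦ toℕ q <? toℕ p ⟧ * F p q))
    (sum-cong-≗ λ q → sum-cong-≗ λ p → cong (⟦ toℕ q <? toℕ p ⟧ *_) (F-sym p q))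

  split : ∀ p q → F p q ≡ ⟦ toℕ p <? toℕ q ⟧ * F p q + ⟦ toℕ q <? toℕ p ⟧ * F p q + ⟦ p ≟ q ⟧ * F p q
  split p q = begin
    F p q                                          ≡⟨ sym (ℤ.*-identityˡ (F p q)) ⟩
    1ℤ * F p q                                     ≡⟨ cong (_* F p q) (sym (trichotomy-indicators p q)) ⟩
    (⟦ toℕ p <? toℕ q ⟧ + ⟦ toℕ q <? toℕ p ⟧ + ⟦ p ≟ q ⟧) * F p q
                                                   ≡⟨ distrib₃ ⟦ toℕ p <? toℕ q ⟧ ⟦ toℕ q <? toℕ p ⟧ ⟦ p ≟ q ⟧ (F p q) ⟩
    ⟦ toℕ p <? toℕ q ⟧ * F p q + ⟦ toℕ q <? toℕ p ⟧ * F p q + ⟦ p ≟ q ⟧ * F p q ∎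
    where
    distrib₃ : ∀ l u d x → (l + u + d) * x ≡ l * x + u * x + d * x
    distrib₃ = solve-∀

  row : ∀ p → ∑[ q < n ] F p q ≡
    ∑[ q < n ] (⟦ toℕ p <? toℕ q ⟧ * F p q) + ∑[ q < n ] (⟦ toℕ q <? toℕ p ⟧ * F p q) + F p p
  row p = begin
    ∑[ q < n ] F p q  ≡⟨ sum-cong-≗ (split p) ⟩
    ∑[ q < n ] (⟦ toℕ p <? toℕ q ⟧ * F p q + ⟦ toℕ q <? toℕ p ⟧ * F p q + ⟦ p ≟ q ⟧ * F p q)
                      ≡⟨ ∑-distrib-+ _ (λ q → ⟦ p ≟ q ⟧ * F p q) ⟩
    ∑[ q < n ] (⟦ toℕ p <? toℕ q ⟧ * F p q + ⟦ toℕ q <? toℕ p ⟧ * F p q) + ∑[ q < n ] (⟦ p ≟ q ⟧ * F p q)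
                      ≡⟨ cong₂ _+_ (∑-distrib-+ (λ q → ⟦ toℕ p <? toℕ q ⟧ * F p q) _) (∑-sift p (F p)) ⟩
    ∑[ q < n ] (⟦ toℕ p <? toℕ q ⟧ * F p q) + ∑[ q < n ] (⟦ toℕ q <? toℕ p ⟧ * F p q) + F p p ∎

  total : ∑[ p < n ] ∑[ q < n ] F p q ≡ Lower + Upper + D
  total = trans (sum-cong-≗ row)
         (trans (∑-distrib-+ {n} _ _) (cong (_+ D) (∑-distrib-+ {n} _ _)))

#τ : ℕ → ℤ
#τ n = + length (transpositions n)

length-transpositions : (n : ℕ) → + 2 * #τ n ≡ + n * + n - + n
length-transpositions n = begin
  + 2 * #τ n
    ≡⟨ cong (+ 2 *_) (sym (trans (sumOver-const (transpositions n) 1ℤ) (ℤ.*-identityʳ (+ length (transpositions n))))) ⟩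
  + 2 * sumOver (transpositions n) (λ _ → 1ℤ)
    ≡⟨ sumOver-transpositions-symmetric n (λ _ _ → 1ℤ) (λ _ _ → refl) ⟩
  ∑[ p < n ] ∑[ q < n ] 1ℤ - ∑[ p < n ] 1ℤ
    ≡⟨ cong₂ _-_ (trans (sum-cong-≗ {n} (λ _ → ∑-const n 1ℤ)) (∑-const n (+ n * 1ℤ))) (∑-const n 1ℤ) ⟩
  + n * (+ n * 1ℤ) - + n * 1ℤ
    ≡⟨ simplify (+ n) ⟩
  + n * + n - + n ∎
  where
  open ≡-Reasoning
  simplify : ∀ x → x * (x * 1ℤ) - x * 1ℤ ≡ x * x - x
  simplify = solve-∀

swapSum : {n : ℕ} → (Fin n → Fin n → ℤ) → Fin n → Fin n → ℤ
swapSum {n} g a b = sumOver (transpositions n) (λ (p , q) → g (swap p q a) (swap p q b))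

swapSum-diagonal : {n : ℕ} (g : Fin n → Fin n → ℤ) {k : ℤ} → (∀ x → g x x ≡ k) →
  (a : Fin n) → swapSum g a a ≡ #τ n * k
swapSum-diagonal {n} g {k} g-diag a =
  trans (sumOver-cong (transpositions n) (λ (p , q) → g-diag (swap p q a))) (sumOver-const (transpositions n) k)

-- A transposition moves the pair (a, b) only if it meets {a, b}: (a c) sends it to (c, b),
-- (b c) to (a, c) and (a b) to (b, a); the remaining #τ n − 2n + 3 fix it.
swapSum-offDiagonal : {n : ℕ} (g : Fin n → Fin n → ℤ) {a b : Fin n} → a ≢ b →
  swapSum g a b ≡ (#τ n - + 2 * + n + 1ℤ) * g a b + g b a + (∑[ c < n ] g c b + ∑[ c < n ] g a c) - g a a - g b b
swapSum-offDiagonal {n} g {a} {b} a≢b = ℤ.*-cancelˡ-≡ (+ 2) _ _ (begin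
  + 2 * swapSum g a b
    ≡⟨ sumOver-transpositions-symmetric n F (λ p q → cong₂ g (swap-comm p q a) (swap-comm p q b)) ⟩
  ∑[ p < n ] ∑[ q < n ] F p q - ∑[ p < n ] F p p
    ≡⟨ cong₂ _-_ double-sum diagonal-sum ⟩
  Gcb + Gac + + n * ((+ n - + 2) * g a b)
    + (Gcb + (g b a - g b b) - R a) + (Gac + (g b a - g a a) - R b) - + n * g a b
    ≡⟨ rearrange (#τ n) (+ n) (g a b) (g b a) (g a a) (g b b) Gcb Gac ⟩
  + 2 * RHS + (+ n * + n - + n - + 2 * #τ n) * g a b
    ≡⟨ cong (λ z → + 2 * RHS + (+ n * + n - + n - z) * g a b) (length-transpositions n) ⟩
  + 2 * RHS + (+ n * + n - + n - (+ n * + n - + n)) * g a b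
    ≡⟨ cong (λ z → + 2 * RHS + z * g a b) (ℤ.+-inverseʳ (+ n * + n - + n)) ⟩
  + 2 * RHS + 0ℤ
    ≡⟨ ℤ.+-identityʳ _ ⟩
  + 2 * RHS ∎)
  where
  open ≡-Reasoning
  F : Fin n → Fin n → ℤ
  F p q = g (swap p q a) (swap p q b)
  Gcb = ∑[ c < n ] g c b
  Gac = ∑[ c < n ] g a c
  RHS = (#τ n - + 2 * + n + 1ℤ) * g a b + g b a + (Gcb + Gac) - g a a - g b b

  b≢a : b ≢ a
  b≢a = a≢b ∘ sym

  R : Fin n → ℤ
  R p = g p b + g a p + (+ n - + 2) * g a b

  row-a : ∑[ q < n ] F a q ≡ Gcb + (g b a - g b b)
  row-a = trans (∑-agreeExcept b (λ q q≢b → cong₂ g (swap-left a q) (swap-fix b≢a (q≢b ∘ sym))))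
                (cong (λ z → Gcb + (z - g b b)) (cong₂ g (swap-left a b) (swap-right a b)))

  row-b : ∑[ q < n ] F b q ≡ Gac + (g b a - g a a)
  row-b = trans (∑-agreeExcept a (λ q q≢a → cong₂ g (swap-fix a≢b (q≢a ∘ sym)) (swap-left b q)))
                (cong (λ z → Gac + (z - g a a)) (cong₂ g (swap-right b a) (swap-left b a)))

  row-other : ∀ p → p ≢ a → p ≢ b → ∑[ q < n ] F p q ≡ R p
  row-other p p≢a p≢b = begin
    ∑[ q < n ] F p q
      ≡⟨ ∑-agreeExcept₂ a b a≢b (λ q q≢a q≢b →
           cong₂ g (swap-fix (p≢a ∘ sym) (q≢a ∘ sym)) (swap-fix (p≢b ∘ sym) (q≢b ∘ sym))) ⟩
    ∑[ q < n ] g a b + (F p a - g a b) + (F p b - g a b)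
      ≡⟨ cong₂ (λ u v → ∑[ q < n ] g a b + (u - g a b) + (v - g a b))
           (cong₂ g (swap-right p a) (swap-fix (p≢b ∘ sym) b≢a))
           (cong₂ g (swap-fix (p≢a ∘ sym) a≢b) (swap-right p b)) ⟩
    ∑[ q < n ] g a b + (g p b - g a b) + (g a p - g a b)
      ≡⟨ cong (λ s → s + (g p b - g a b) + (g a p - g a b)) (∑-const n (g a b)) ⟩
    + n * g a b + (g p b - g a b) + (g a p - g a b)
      ≡⟨ regroup (+ n) (g a b) (g p b) (g a p) ⟩
    R p ∎
    where
    regroup : ∀ m x u v → m * x + (u - x) + (v - x) ≡ u + v + (m - + 2) * x
    regroup = solve-∀

  ∑R : ∑[ p < n ] R p ≡ Gcb + Gac + + n * ((+ n - + 2) * g a b)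
  ∑R = trans (∑-distrib-+ {n} (λ p → g p b + g a p) _)
             (cong₂ _+_ (∑-distrib-+ {n} (λ p → g p b) _) (∑-const n _))

  double-sum : ∑[ p < n ] ∑[ q < n ] F p q
             ≡ Gcb + Gac + + n * ((+ n - + 2) * g a b) + (Gcb + (g b a - g b b) - R a) + (Gac + (g b a - g a a) - R b)
  double-sum = trans (∑-agreeExcept₂ a b a≢b row-other)
    (cong₂ _+_ (cong₂ (λ s r → s + (r - R a)) ∑R row-a) (cong (_- R b) row-b))

  diagonal-sum : ∑[ p < n ] F p p ≡ + n * g a b
  diagonal-sum = trans (sum-cong-≗ (λ p → cong₂ g (swap-self p a) (swap-self p b))) (∑-const n (g a b))

  rearrange : ∀ N m x y u v s r →
    s + r + m * ((m - + 2) * x) + (s + (y - v) - (x + u + (m - + 2) * x)) + (r + (y - u) - (v + x + (m - + 2) * x)) - m * x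
    ≡ + 2 * ((N - + 2 * m + 1ℤ) * x + y + (s + r) - u - v) + (m * m - m - + 2 * N) * x
  rearrange = solve-∀

-- An invariant family of functions on pairs

record Coeffs : Set where
  constructor coeffs
  field
    inversion gap constant diagonal : ℤ

open Coeffs

eval : {n : ℕ} → Coeffs → Fin n → Fin n → ℤ
eval (coeffs A B C D) x y = A * ⟦ toℕ y <? toℕ x ⟧ + B * (+ toℕ y - + toℕ x) + C + D * ⟦ x ≟ y ⟧

step : ℕ → Coeffs → Coeffs
step n (coeffs A B C D) =
  coeffs ((N - + 2 * + n) * A) ((N - + n) * B - A) (+ n * A + N * C) (N * D - + n * A)
  where N = #τ n

eval-diagonal : {n : ℕ} (k : Coeffs) (x : Fin n) → eval k x x ≡ constant k + diagonal k
eval-diagonal (coeffs A B C D) x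
  rewrite ⟦⟧-no (toℕ x <? toℕ x) (ℕ.<-irrefl refl) | ℤ.+-inverseʳ (+ toℕ x) | ⟦⟧-yes (x ≟ x) refl =
  simplify A B C D
  where
  simplify : ∀ A B C D → A * 0ℤ + B * 0ℤ + C + D * 1ℤ ≡ C + D
  simplify = solve-∀

eval-offDiagonal : {n : ℕ} (k : Coeffs) {x y : Fin n} → x ≢ y →
  eval k x y ≡ inversion k * ⟦ toℕ y <? toℕ x ⟧ + gap k * (+ toℕ y - + toℕ x) + constant k
eval-offDiagonal (coeffs A B C D) {x} {y} x≢y rewrite ⟦⟧-no (x ≟ y) x≢y =
  simplify (A * ⟦ toℕ y <? toℕ x ⟧ + B * (+ toℕ y - + toℕ x) + C) D
  where
  simplify : ∀ s D → s + D * 0ℤ ≡ s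
  simplify = solve-∀

⟦<⟧-flip : {n : ℕ} {x y : Fin n} → x ≢ y → ⟦ toℕ x <? toℕ y ⟧ + ⟦ toℕ y <? toℕ x ⟧ ≡ 1ℤ
⟦<⟧-flip {x = x} {y} x≢y = begin
  ⟦ toℕ x <? toℕ y ⟧ + ⟦ toℕ y <? toℕ x ⟧            ≡⟨ sym (ℤ.+-identityʳ _) ⟩
  ⟦ toℕ x <? toℕ y ⟧ + ⟦ toℕ y <? toℕ x ⟧ + 0ℤ       ≡⟨ cong (_+_ (⟦ toℕ x <? toℕ y ⟧ + ⟦ toℕ y <? toℕ x ⟧)) (sym (⟦⟧-no (x ≟ y) x≢y)) ⟩
  ⟦ toℕ x <? toℕ y ⟧ + ⟦ toℕ y <? toℕ x ⟧ + ⟦ x ≟ y ⟧ ≡⟨ trichotomy-indicators x y ⟩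
  1ℤ                                                  ∎
  where open ≡-Reasoning

∑-affine : (n : ℕ) (A K D : ℤ) (f h : Fin n → ℤ) →
  ∑[ c < n ] (A * f c + K + D * h c) ≡ A * ∑[ c < n ] f c + + n * K + D * ∑[ c < n ] h c
∑-affine n A K D f h = begin
  ∑[ c < n ] (A * f c + K + D * h c)
    ≡⟨ ∑-distrib-+ {n} (λ c → A * f c + K) _ ⟩
  ∑[ c < n ] (A * f c + K) + ∑[ c < n ] (D * h c)
    ≡⟨ cong₂ _+_ (∑-distrib-+ {n} (λ c → A * f c) _) (sym (*-distribˡ-sum D h)) ⟩
  ∑[ c < n ] (A * f c) + ∑[ c < n ] K + D * ∑[ c < n ] h c
    ≡⟨ cong₂ (λ u v → u + v + D * ∑[ c < n ] h c) (sym (*-distribˡ-sum A f)) (∑-const n K) ⟩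
  A * ∑[ c < n ] f c + + n * K + D * ∑[ c < n ] h c ∎
  where open ≡-Reasoning

∑-eval-column+row : {n : ℕ} (k : Coeffs) (a b : Fin n) →
  ∑[ c < n ] eval k c b + ∑[ c < n ] eval k a c
  ≡ inversion k * (+ n - + toℕ b - 1ℤ + + toℕ a) + + n * (gap k * (+ toℕ b - + toℕ a) + + 2 * constant k)
    + diagonal k * + 2
∑-eval-column+row {n} (coeffs A B C D) a b = begin
  ∑[ c < n ] eval k c b + ∑[ c < n ] eval k a c
    ≡⟨ sym (∑-distrib-+ {n} _ _) ⟩
  ∑[ c < n ] (eval k c b + eval k a c)
    ≡⟨ sum-cong-≗ (λ c → regroup A B C D ⟦ toℕ b <? toℕ c ⟧ ⟦ toℕ c <? toℕ a ⟧ ⟦ c ≟ b ⟧ ⟦ a ≟ c ⟧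
                                   (+ toℕ a) (+ toℕ b) (+ toℕ c)) ⟩
  ∑[ c < n ] (A * (⟦ toℕ b <? toℕ c ⟧ + ⟦ toℕ c <? toℕ a ⟧) + K + D * (⟦ c ≟ b ⟧ + ⟦ a ≟ c ⟧))
    ≡⟨ ∑-affine n A K D _ _ ⟩
  A * ∑[ c < n ] (⟦ toℕ b <? toℕ c ⟧ + ⟦ toℕ c <? toℕ a ⟧) + + n * K + D * ∑[ c < n ] (⟦ c ≟ b ⟧ + ⟦ a ≟ c ⟧)
    ≡⟨ cong₂ (λ u v → A * u + + n * K + D * v) count-order count-equal ⟩
  A * (+ n - + toℕ b - 1ℤ + + toℕ a) + + n * K + D * + 2 ∎
  where
  open ≡-Reasoning
  k = coeffs A B C D
  K = B * (+ toℕ b - + toℕ a) + + 2 * C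

  regroup : ∀ A B C D u v w w′ x y z →
    A * u + B * (y - z) + C + D * w + (A * v + B * (z - x) + C + D * w′)
    ≡ A * (u + v) + (B * (y - x) + + 2 * C) + D * (w + w′)
  regroup = solve-∀

  count-order : ∑[ c < n ] (⟦ toℕ b <? toℕ c ⟧ + ⟦ toℕ c <? toℕ a ⟧) ≡ + n - + toℕ b - 1ℤ + + toℕ a
  count-order = trans (∑-distrib-+ {n} _ _) (cong₂ _+_ (∑-⟦>⟧ b) (∑-⟦<⟧ n (toℕ a) (ℕ.<⇒≤ (toℕ<n a))))

  count-equal : ∑[ c < n ] (⟦ c ≟ b ⟧ + ⟦ a ≟ c ⟧) ≡ + 2
  count-equal = trans (∑-distrib-+ {n} _ _)
    (cong₂ _+_ (trans (sum-cong-≗ (λ c → ⟦≟⟧-sym c b)) (∑-⟦≟⟧ b)) (∑-⟦≟⟧ a))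

swapSum-eval-diagonal : (n : ℕ) (k : Coeffs) (a : Fin n) → swapSum (eval k) a a ≡ eval (step n k) a a
swapSum-eval-diagonal n k@(coeffs A B C D) a = begin
  swapSum (eval k) a a                ≡⟨ swapSum-diagonal (eval k) (eval-diagonal k) a ⟩
  N * (C + D)                         ≡⟨ regroup N (+ n) A C D ⟩
  + n * A + N * C + (N * D - + n * A) ≡⟨ sym (eval-diagonal (step n k) a) ⟩
  eval (step n k) a a                 ∎
  where
  open ≡-Reasoning
  N = #τ n
  regroup : ∀ N m A C D → N * (C + D) ≡ m * A + N * C + (N * D - m * A)
  regroup = solve-∀

swapSum-eval-offDiagonal : (n : ℕ) (k : Coeffs) {a b : Fin n} → a ≢ b →
  swapSum (eval k) a b ≡ eval (step n k) a b
swapSum-eval-offDiagonal n k@(coeffs A B C D) {a} {b} a≢b = begin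
  swapSum (eval k) a b
    ≡⟨ swapSum-offDiagonal (eval k) a≢b ⟩
  Φ (eval k a b) (eval k b a) sums (eval k a a) (eval k b b)
    ≡⟨ cong₂ (λ u v → Φ u v sums (eval k a a) (eval k b b)) (eval-offDiagonal k a≢b) (eval-offDiagonal k (a≢b ∘ sym)) ⟩
  Φ eab eba sums (eval k a a) (eval k b b)
    ≡⟨ cong₂ (λ s e → Φ eab eba s e (eval k b b)) (∑-eval-column+row k a b) (eval-diagonal k a) ⟩
  Φ eab eba cross (C + D) (eval k b b)
    ≡⟨ cong (Φ eab eba cross (C + D)) (eval-diagonal k b) ⟩
  Φ eab eba cross (C + D) (C + D)
    ≡⟨ regroup N (+ n) A B C D x y ι ι′ ⟩
  (N - + 2 * + n) * A * ι + ((N - + n) * B - A) * (y - x) + (+ n * A + N * C) + A * (ι′ + ι - 1ℤ)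
    ≡⟨ cong (λ z → (N - + 2 * + n) * A * ι + ((N - + n) * B - A) * (y - x) + (+ n * A + N * C) + A * (z - 1ℤ))
            (⟦<⟧-flip a≢b) ⟩
  (N - + 2 * + n) * A * ι + ((N - + n) * B - A) * (y - x) + (+ n * A + N * C) + A * 0ℤ
    ≡⟨ drop-zero _ A ⟩
  (N - + 2 * + n) * A * ι + ((N - + n) * B - A) * (y - x) + (+ n * A + N * C)
    ≡⟨ sym (eval-offDiagonal (step n k) a≢b) ⟩
  eval (step n k) a b ∎
  where
  open ≡-Reasoning
  N = #τ n
  x = + toℕ a
  y = + toℕ b
  ι = ⟦ toℕ b <? toℕ a ⟧
  ι′ = ⟦ toℕ a <? toℕ b ⟧
  eab = A * ι + B * (y - x) + C
  eba = A * ι′ + B * (x - y) + C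
  sums = ∑[ c < n ] eval k c b + ∑[ c < n ] eval k a c
  cross = A * (+ n - y - 1ℤ + x) + + n * (B * (y - x) + + 2 * C) + D * + 2

  Φ : ℤ → ℤ → ℤ → ℤ → ℤ → ℤ
  Φ u v s e f = (N - + 2 * + n + 1ℤ) * u + v + s - e - f

  regroup : ∀ N m A B C D x y ι ι′ →
    (N - + 2 * m + 1ℤ) * (A * ι + B * (y - x) + C) + (A * ι′ + B * (x - y) + C)
      + (A * (m - y - 1ℤ + x) + m * (B * (y - x) + + 2 * C) + D * + 2) - (C + D) - (C + D)
    ≡ (N - + 2 * m) * A * ι + ((N - m) * B - A) * (y - x) + (m * A + N * C) + A * (ι′ + ι - 1ℤ)
  regroup = solve-∀

  drop-zero : ∀ s A → s + A * 0ℤ ≡ s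
  drop-zero = solve-∀

swapSum-eval : (n : ℕ) (k : Coeffs) (a b : Fin n) → swapSum (eval k) a b ≡ eval (step n k) a b
swapSum-eval n k a b = by-cases (a ≟ b)
  where
  by-cases : Dec (a ≡ b) → swapSum (eval k) a b ≡ eval (step n k) a b
  by-cases (yes refl) = swapSum-eval-diagonal n k a
  by-cases (no a≢b)   = swapSum-eval-offDiagonal n k a≢b

-- Products of transpositions

sumOver-sequences-suc : (n t : ℕ) (g : Fin n → Fin n → ℤ) (x y : Fin n) →
  sumOver (sequences n (suc t)) (λ s → g (product s x) (product s y))
  ≡ sumOver (sequences n t) (λ s → swapSum g (product s x) (product s y))
sumOver-sequences-suc n t g x y = begin
  sumOver (sequences n (suc t)) G
    ≡⟨ sumOver-concatMap (λ τ → map (τ ∷_) (sequences n t)) (transpositions n) G ⟩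
  sumOver (transpositions n) (λ τ → sumOver (map (τ ∷_) (sequences n t)) G)
    ≡⟨ sumOver-cong (transpositions n) (λ τ → sumOver-map (τ ∷_) (sequences n t) G) ⟩
  sumOver (transpositions n) (λ τ → sumOver (sequences n t) (λ s → G (τ ∷ s)))
    ≡⟨ sumOver-comm (transpositions n) (sequences n t) (λ τ s → G (τ ∷ s)) ⟩
  sumOver (sequences n t) (λ s → swapSum g (product s x) (product s y)) ∎
  where
  open ≡-Reasoning
  G : List (Transp n) → ℤ
  G s = g (product s x) (product s y)

iterate : {A : Set} → (A → A) → ℕ → A → A
iterate f zero    x = x
iterate f (suc t) x = iterate f t (f x)

sumOver-sequences-eval : (n t : ℕ) (k : Coeffs) (x y : Fin n) →
  sumOver (sequences n t) (λ s → eval k (product s x) (product s y)) ≡ eval (iterate (step n) t k) x y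
sumOver-sequences-eval n zero    k x y = ℤ.+-identityʳ (eval k x y)
sumOver-sequences-eval n (suc t) k x y =
  trans (sumOver-sequences-suc n t (eval k) x y)
 (trans (sumOver-cong (sequences n t) (λ s → swapSum-eval n k (product s x) (product s y)))
        (sumOver-sequences-eval n t (step n k) x y))

eval-inversionIndicator : {n : ℕ} (x y : Fin n) → eval (coeffs 1ℤ 0ℤ 0ℤ 0ℤ) x y ≡ ⟦ toℕ y <? toℕ x ⟧
eval-inversionIndicator x y = simplify ⟦ toℕ y <? toℕ x ⟧ (+ toℕ y - + toℕ x) ⟦ x ≟ y ⟧
  where
  simplify : ∀ ι d δ → 1ℤ * ι + 0ℤ * d + 0ℤ + 0ℤ * δ ≡ ι
  simplify = solve-∀

countInv-eval : (n t : ℕ) (i j : Fin n) → + countInv n t i j ≡ eval (iterate (step n) t (coeffs 1ℤ 0ℤ 0ℤ 0ℤ)) i j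
countInv-eval n t i j =
  trans (length-filter (λ s → toℕ (product s j) <? toℕ (product s i)) (sequences n t))
 (trans (sumOver-cong (sequences n t) (λ s → sym (eval-inversionIndicator (product s i) (product s j))))
        (sumOver-sequences-eval n t (coeffs 1ℤ 0ℤ 0ℤ 0ℤ) i j))

eval-< : {n : ℕ} (k : Coeffs) {x y : Fin n} → toℕ x < toℕ y →
  eval k x y ≡ gap k * + (toℕ y ∸ toℕ x) + constant k
eval-< k {x} {y} x<y = begin
  eval k x y
    ≡⟨ eval-offDiagonal k (ℕ.<⇒≢ x<y ∘ cong toℕ) ⟩
  inversion k * ⟦ toℕ y <? toℕ x ⟧ + gap k * (+ toℕ y - + toℕ x) + constant k
    ≡⟨ cong₂ (λ ι d → inversion k * ι + gap k * d + constant k)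
             (⟦⟧-no (toℕ y <? toℕ x) (ℕ.<⇒≯ x<y))
             (trans (ℤ.m-n≡m⊖n (toℕ y) (toℕ x)) (ℤ.⊖-≥ (ℕ.<⇒≤ x<y))) ⟩
  inversion k * 0ℤ + gap k * + (toℕ y ∸ toℕ x) + constant k
    ≡⟨ drop-zero (inversion k) (gap k * + (toℕ y ∸ toℕ x)) (constant k) ⟩
  gap k * + (toℕ y ∸ toℕ x) + constant k ∎
  where
  open ≡-Reasoning
  drop-zero : ∀ A u C → A * 0ℤ + u + C ≡ u + C
  drop-zero = solve-∀

countInv-translationInvariant : (n t : ℕ) {i j i′ j′ : Fin n} → toℕ i < toℕ j → toℕ i′ < toℕ j′ →
  toℕ j ∸ toℕ i ≡ toℕ j′ ∸ toℕ i′ → countInv n t i j ≡ countInv n t i′ j′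
countInv-translationInvariant n t {i} {j} {i′} {j′} i<j i′<j′ same-gap = ℤ.+-injective (begin
  + countInv n t i j                             ≡⟨ countInv-eval n t i j ⟩
  eval k i j                                     ≡⟨ eval-< k i<j ⟩
  gap k * + (toℕ j ∸ toℕ i) + constant k         ≡⟨ cong (λ d → gap k * + d + constant k) same-gap ⟩
  gap k * + (toℕ j′ ∸ toℕ i′) + constant k       ≡⟨ sym (eval-< k i′<j′) ⟩
  eval k i′ j′                                   ≡⟨ sym (countInv-eval n t i′ j′) ⟩
  + countInv n t i′ j′                           ∎)
  where
  open ≡-Reasoning
  k = iterate (step n) t (coeffs 1ℤ 0ℤ 0ℤ 0ℤ)

mainTheorem4 : (n t : ℕ) → 2 ≤ n → (i j i′ j′ : Fin n) →
    toℕ i < toℕ j → toℕ i′ < toℕ j′ → toℕ j ∸ toℕ i ≡ toℕ j′ ∸ toℕ i′ →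
    Pr-inv n t i j ≃ Pr-inv n t i′ j′
mainTheorem4 n t _ i j i′ j′ i<j i′<j′ same-gap
  rewrite countInv-translationInvariant n t i<j i′<j′ same-gap = ≃-refl
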